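{- Fix an integer $b$ with $1\le b\le 9$, $b\ne7$, and let $S_b=\{(x,y,z)\in\mathbb{Z}_{>0}^3:(x+y+z)^2=bxyz\}$. Let $s_0=(x,y_0,z_0)\in S_b$ satisfy $x\le y_0\le z_0\le x+y_0$. Define recursively, for $j\ge 0$, $y_{j+1}=z_j$ and $z_{j+1}=bxy_{j+1}-2(x+y_{j+1})-y_j$, and set $s_j=(x,y_j,z_j)$. Then for all $j\in\mathbb{Z}_{>0}$, $s_j\in S_b$ and $z_{j-1}<z_j$. Moreover, $x$ divides $y_j$ and $z_j$ for all $j\ge 0$. -}

module Defs where

open import Data.Nat using (ℕ; zero; suc)
open import Data.Integer using (ℤ; +_; _+_; _-_; _*_; _<_)
open import Data.Product using (_×_; _,_; proj₁; proj₂)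
open import Relation.Binary.PropositionalEquality using (_≡_)

InS : ℤ → ℤ → ℤ → ℤ → Set
InS b x y z =
  (+ 0 < x) × (+ 0 < y) × (+ 0 < z) ×
  ((x + y + z) * (x + y + z) ≡ b * x * y * z)

yz : ℤ → ℤ → ℤ → ℤ → ℕ → ℤ × ℤ
yz b x y0 z0 zero = y0 , z0
yz b x y0 z0 (suc j) with yz b x y0 z0 j
... | (yj , zj) = zj , (b * x * zj - + 2 * (x + zj) - yj)

ySeq : ℤ → ℤ → ℤ → ℤ → ℕ → ℤ
ySeq b x y0 z0 j = proj₁ (yz b x y0 z0 j)

zSeq : ℤ → ℤ → ℤ → ℤ → ℕ → ℤ
zSeq b x y0 z0 j = proj₂ (yz b x y0 z0 j)

{-# OPTIONS --safe #-}
-- For fixed b, x, z the equation (x + t + z)² = b x t z is a monic quadratic in t whose roots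
-- sum to b x z − 2 (x + z) and multiply to (x + z)². Hence the jump y ↦ y′ = b x z − 2 (x + z) − y
-- turns the solution (x, y, z) into the solution (x, z, y′), and y y′ = (x + z)² > y z gives
-- y′ > z when y ≤ z. As y′ is an integral combination of x, y, z, divisibility by x propagates.
-- For the initial solution, x ≤ y ≤ z ≤ x + y gives 4 y z < (x + y + z)² = b x y z and
-- b x y² ≤ 4 (x + y)² ≤ (4 y + 12 x) y, so 5 ≤ b x ≤ 16 and y ≤ 12 x: finitely many cases,
-- which are checked by computation.
module Submission where

module FundamentalSolution where
  open import Data.Nat
  open import Data.Nat.Properties
  open import Data.Nat.Divisibility using (_∣_; _∣?_)
  open import Data.Nat.Tactic.RingSolver using (solve)
  open import Data.List using ([]; _∷_)
  open import Data.Product using (_×_; _,_)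
  open import Data.Unit using (tt)
  open import Relation.Binary.PropositionalEquality using (_≡_; refl)
  open import Relation.Nullary.Decidable using (Dec; yes; no; map′; _×-dec_; _→-dec_; toWitness)

  -- Unlike allUpTo?, which matches on the decisions of P?, this computes 'does' without
  -- evaluating any proof, so the search below normalises quickly.
  allBelow? : ∀ n {P : ℕ → Set} → (∀ i → Dec (P i)) → Dec (∀ i → i < n → P i)
  allBelow? zero        P? = yes λ _ ()
  allBelow? (suc n) {P} P? = map′ extend restrict (P? n ×-dec allBelow? n P?)
    where
    extend : P n × (∀ i → i < n → P i) → ∀ i → i < suc n → P i
    extend (Pn , P<n) i (s≤s i≤n) with i ≟ n
    ... | yes refl = Pn
    ... | no i≢n   = P<n i (≤∧≢⇒< i≤n i≢n)
    restrict : (∀ i → i < suc n → P i) → P n × (∀ i → i < n → P i)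
    restrict P<1+n = P<1+n n ≤-refl , λ i i<n → P<1+n i (m≤n⇒m≤1+n i<n)

  DivisibleIfSolution : ℕ → ℕ → ℕ → ℕ → Set
  DivisibleIfSolution b x y z = (x + y + z) * (x + y + z) ≡ b * x * y * z → x ∣ y × x ∣ z

  divisibleIfSolution? : ∀ b x y z → Dec (DivisibleIfSolution b x y z)
  divisibleIfSolution? b x y z =
    ((x + y + z) * (x + y + z) ≟ b * x * y * z) →-dec (x ∣? y ×-dec x ∣? z)

  SmallSolutionsDivisible : Set
  SmallSolutionsDivisible =
    ∀ b → b < 10 → ∀ x → x < 17 → 4 < b * x → b * x ≤ 16 →
    ∀ y → y < suc (12 * x) → x ≤ y → b * x * y ≤ 4 * y + 12 * x →
    ∀ z → z < suc (x + y) → y ≤ z → DivisibleIfSolution b x y z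

  smallSolutionsDivisible : SmallSolutionsDivisible
  smallSolutionsDivisible = toWitness {a? = search} tt
    where
    search : Dec SmallSolutionsDivisible
    search =
      allBelow? 10 λ b → allBelow? 17 λ x → (4 <? b * x) →-dec (b * x ≤? 16) →-dec
      allBelow? (suc (12 * x)) λ y → (x ≤? y) →-dec (b * x * y ≤? 4 * y + 12 * x) →-dec
      allBelow? (suc (x + y)) λ z → (y ≤? z) →-dec divisibleIfSolution? b x y z

  module _ {b x y z : ℕ} (1≤x : 1 ≤ x) (x≤y : x ≤ y) (y≤z : y ≤ z) (z≤x+y : z ≤ x + y)
           (solution : (x + y + z) * (x + y + z) ≡ b * x * y * z) where

    private
      instance
        y≢0 : NonZero y
        y≢0 = >-nonZero (≤-trans 1≤x x≤y)
        z≢0 : NonZero z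
        z≢0 = >-nonZero (≤-trans (≤-trans 1≤x x≤y) y≤z)

    4<bx : 4 < b * x
    4<bx = *-cancelʳ-< (y * z) 4 (b * x) (begin-strict
      4 * (y * z)                 ≡⟨ solve (y ∷ z ∷ []) ⟩
      (y + y) * (z + z)           <⟨ *-monoˡ-< (z + z) {{>-nonZero (+-mono-< z>0 z>0)}} 2y<s ⟩
      (x + y + z) * (z + z)       ≤⟨ *-monoʳ-≤ (x + y + z) (+-monoˡ-≤ z z≤x+y) ⟩
      (x + y + z) * (x + y + z)   ≡⟨ solution ⟩
      b * x * y * z               ≡⟨ *-assoc (b * x) y z ⟩
      b * x * (y * z)             ∎)
      where
      open ≤-Reasoning
      z>0 : 0 < z
      z>0 = >-nonZero⁻¹ z
      2y<s : y + y < x + y + z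
      2y<s = +-mono-≤ (+-monoˡ-≤ y 1≤x) y≤z

    bxy≤4y+12x : b * x * y ≤ 4 * y + 12 * x
    bxy≤4y+12x = *-cancelʳ-≤ (b * x * y) (4 * y + 12 * x) y (begin
      b * x * y * y                   ≤⟨ *-monoʳ-≤ (b * x * y) y≤z ⟩
      b * x * y * z                   ≡⟨ solution ⟨
      (x + y + z) * (x + y + z)       ≤⟨ *-mono-≤ s≤2[x+y] s≤2[x+y] ⟩
      (x + y + (x + y)) * (x + y + (x + y))
                                      ≡⟨ solve (x ∷ y ∷ []) ⟩
      (4 * y + 8 * x) * y + 4 * x * x ≤⟨ +-monoʳ-≤ ((4 * y + 8 * x) * y) (*-monoʳ-≤ (4 * x) x≤y) ⟩
      (4 * y + 8 * x) * y + 4 * x * y ≡⟨ solve (x ∷ y ∷ []) ⟩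
      (4 * y + 12 * x) * y            ∎)
      where
      open ≤-Reasoning
      s≤2[x+y] : x + y + z ≤ x + y + (x + y)
      s≤2[x+y] = +-monoʳ-≤ (x + y) z≤x+y

    bx≤16 : b * x ≤ 16
    bx≤16 = *-cancelʳ-≤ (b * x) 16 y (begin
      b * x * y       ≤⟨ bxy≤4y+12x ⟩
      4 * y + 12 * x  ≤⟨ +-monoʳ-≤ (4 * y) (*-monoʳ-≤ 12 x≤y) ⟩
      4 * y + 12 * y  ≡⟨ *-distribʳ-+ y 4 12 ⟨
      16 * y          ∎)
      where open ≤-Reasoning

    y≤12x : y ≤ 12 * x
    y≤12x = +-cancelˡ-≤ (4 * y) y (12 * x) (begin
      4 * y + y       ≡⟨ +-comm (4 * y) y ⟩
      5 * y           ≤⟨ *-monoˡ-≤ y 4<bx ⟩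
      b * x * y       ≤⟨ bxy≤4y+12x ⟩
      4 * y + 12 * x  ∎)
      where open ≤-Reasoning

    x∣y×x∣z : 1 ≤ b → b ≤ 9 → x ∣ y × x ∣ z
    x∣y×x∣z 1≤b b≤9 =
      smallSolutionsDivisible b (s≤s b≤9) x (s≤s x≤16) 4<bx bx≤16
        y (s≤s y≤12x) x≤y bxy≤4y+12x z (s≤s z≤x+y) y≤z solution
      where
      x≤16 : x ≤ 16
      x≤16 = ≤-trans (m≤n*m x b {{>-nonZero 1≤b}}) bx≤16

open import Defs
open import Data.Nat using (ℕ; zero; suc; s≤s; z<s)
open import Data.Nat.Properties using (m<n+m)
import Data.Nat as ℕ
open import Data.Integer using (ℤ; +_; _+_; _-_; _*_; _≤_; _<_; +≤+; +<+)
open import Data.Integer.Divisibility using (_∣_)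
import Data.Integer.Divisibility.Signed as Signed
open import Data.Integer.Properties
  using (+-injective; pos-*; <⇒≤; <-trans; i≡j⇒i-j≡0; i-j≡0⇒i≡j;
         *-monoʳ-≤-nonNeg; +-identityʳ; *-monoˡ-<-pos; *-monoʳ-<-pos; *-cancelˡ-<-nonNeg; module ≤-Reasoning)
open import Data.Integer.Tactic.RingSolver using (solve-∀)
open import Data.Product using (_×_; _,_; map₂; uncurry)
open import Relation.Binary.PropositionalEquality using (_≡_; _≢_; trans; cong; module ≡-Reasoning)

jump : ℤ → ℤ → ℤ → ℤ → ℤ
jump b x y z = b * x * z - + 2 * (x + z) - y

-- w is jump b x y z written out, as the ring solver does not unfold definitions.
quadratic-jump : ∀ b x y z → let w = b * x * z - + 2 * (x + z) - y in
  (x + z + w) * (x + z + w) - b * x * z * w ≡ (x + y + z) * (x + y + z) - b * x * y * z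
quadratic-jump = solve-∀

vieta-product : ∀ b x y z → let w = b * x * z - + 2 * (x + z) - y in
  y * w + ((x + y + z) * (x + y + z) - b * x * y * z) ≡ (x + z) * (x + z)
vieta-product = solve-∀

module _ (b x y z : ℤ) (solution : (x + y + z) * (x + y + z) ≡ b * x * y * z) where

  jump-solution : (x + z + jump b x y z) * (x + z + jump b x y z) ≡ b * x * z * jump b x y z
  jump-solution = i-j≡0⇒i≡j _ _ (trans (quadratic-jump b x y z) (i≡j⇒i-j≡0 solution))

  y*jump≡[x+z]² : y * jump b x y z ≡ (x + z) * (x + z)
  y*jump≡[x+z]² = begin
    y * jump b x y z                                                 ≡⟨ +-identityʳ _ ⟨
    y * jump b x y z + + 0                                           ≡⟨ cong (λ e → y * jump b x y z + e) (i≡j⇒i-j≡0 solution) ⟨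
    y * jump b x y z + ((x + y + z) * (x + y + z) - b * x * y * z)   ≡⟨ vieta-product b x y z ⟩
    (x + z) * (x + z)                                                ∎
    where open ≡-Reasoning

z<jump : ∀ b {x y z} → InS b x y z → y ≤ z → z < jump b x y z
z<jump b {x} {y} {z} (+<+ (s≤s _) , +<+ (s≤s _) , +<+ (s≤s _) , solution) y≤z =
  *-cancelˡ-<-nonNeg y (begin-strict
    y * z                  ≤⟨ *-monoʳ-≤-nonNeg z y≤z ⟩
    z * z                  <⟨ *-monoˡ-<-pos z z<x+z ⟩
    z * (x + z)            <⟨ *-monoʳ-<-pos (x + z) z<x+z ⟩
    (x + z) * (x + z)      ≡⟨ y*jump≡[x+z]² b x y z solution ⟨
    y * jump b x y z       ∎)
  where
  open ≤-Reasoning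
  z<x+z : z < x + z
  z<x+z = +<+ (m<n+m _ z<s)

InS-jump : ∀ b {x y z} → InS b x y z → y ≤ z → InS b x z (jump b x y z) × z < jump b x y z
InS-jump b {x} {y} {z} s@(0<x , _ , 0<z , solution) y≤z =
  (0<x , 0<z , <-trans 0<z z<w , jump-solution b x y z solution) , z<w
  where
  z<w : z < jump b x y z
  z<w = z<jump b s y≤z

∣-jump : ∀ b x y z → x ∣ y → x ∣ z → x ∣ jump b x y z
∣-jump b x y z x∣y x∣z = Signed.∣⇒∣ᵤ (∣m∣n⇒∣m-n (∣m∣n⇒∣m-n x∣bxz x∣2[x+z]) (Signed.∣ᵤ⇒∣ x∣y))
  where
  open Signed using (∣m∣n⇒∣m-n; ∣m∣n⇒∣m+n; ∣n⇒∣m*n; ∣-refl)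
  x∣ˢz : x Signed.∣ z
  x∣ˢz = Signed.∣ᵤ⇒∣ x∣z
  x∣bxz : x Signed.∣ b * x * z
  x∣bxz = ∣n⇒∣m*n (b * x) x∣ˢz
  x∣2[x+z] : x Signed.∣ + 2 * (x + z)
  x∣2[x+z] = ∣n⇒∣m*n (+ 2) (∣m∣n⇒∣m+n ∣-refl x∣ˢz)

ℕ-solution : ∀ b x y z → + (x ℕ.+ y ℕ.+ z) * + (x ℕ.+ y ℕ.+ z) ≡ + b * + x * + y * + z →
  (x ℕ.+ y ℕ.+ z) ℕ.* (x ℕ.+ y ℕ.+ z) ≡ b ℕ.* x ℕ.* y ℕ.* z
ℕ-solution b x y z solution = +-injective (begin
  + ((x ℕ.+ y ℕ.+ z) ℕ.* (x ℕ.+ y ℕ.+ z))  ≡⟨ pos-* (x ℕ.+ y ℕ.+ z) (x ℕ.+ y ℕ.+ z) ⟩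
  + (x ℕ.+ y ℕ.+ z) * + (x ℕ.+ y ℕ.+ z)    ≡⟨ solution ⟩
  + b * + x * + y * + z                    ≡⟨ cong (λ t → t * + y * + z) (pos-* b x) ⟨
  + (b ℕ.* x) * + y * + z                  ≡⟨ cong (_* + z) (pos-* (b ℕ.* x) y) ⟨
  + (b ℕ.* x ℕ.* y) * + z                  ≡⟨ pos-* (b ℕ.* x ℕ.* y) z ⟨
  + (b ℕ.* x ℕ.* y ℕ.* z)                  ∎)
  where open ≡-Reasoning

InS⇒x∣y×x∣z : ∀ {b x y z} → + 1 ≤ b → b ≤ + 9 →
  InS b x y z → x ≤ y → y ≤ z → z ≤ x + y → x ∣ y × x ∣ z
InS⇒x∣y×x∣z (+≤+ {n = b} 1≤b) (+≤+ b≤9) (+<+ {n = x} 1≤x , _ , _ , solution)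
             (+≤+ {n = y} x≤y) (+≤+ {n = z} y≤z) (+≤+ z≤x+y) =
  FundamentalSolution.x∣y×x∣z 1≤x x≤y y≤z z≤x+y (ℕ-solution b x y z solution) 1≤b b≤9

lemma6p2 : (b x y0 z0 : ℤ) → + 1 ≤ b → b ≤ + 9 → b ≢ + 7 →
    InS b x y0 z0 → x ≤ y0 → y0 ≤ z0 → z0 ≤ x + y0 →
    ((j : ℕ) →
      InS b x (ySeq b x y0 z0 (suc j)) (zSeq b x y0 z0 (suc j)) ×
      zSeq b x y0 z0 j < zSeq b x y0 z0 (suc j)) ×
    ((j : ℕ) → (x ∣ ySeq b x y0 z0 j) × (x ∣ zSeq b x y0 z0 j))
lemma6p2 b x y0 z0 1≤b b≤9 _ s₀ x≤y₀ y₀≤z₀ z₀≤x+y₀ =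
  (λ j → uncurry (InS-jump b) (ordered j)) , divides
  where
  y z : ℕ → ℤ
  y = ySeq b x y0 z0
  z = zSeq b x y0 z0
  ordered : ∀ j → InS b x (y j) (z j) × y j ≤ z j
  ordered zero    = s₀ , y₀≤z₀
  ordered (suc j) = map₂ <⇒≤ (uncurry (InS-jump b) (ordered j))
  divides : ∀ j → x ∣ y j × x ∣ z j
  divides zero    = InS⇒x∣y×x∣z 1≤b b≤9 s₀ x≤y₀ y₀≤z₀ z₀≤x+y₀
  divides (suc j) = let x∣y , x∣z = divides j in x∣z , ∣-jump b x (y j) (z j) x∣y x∣z
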